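{- Let $l,k$ be integers with $l\neq 0$ and $l$ dividing $k(k-1)$. Let $\mathbb{Z}=C_{1}\cup C_{2}\cup\cdots\cup C_{r}$ be any finite partition of $\mathbb{Z}$. Then for each $m\in\mathbb{N}$ there exist $x,y,z\in\mathbb{Z}$ and an index $s\in\{1,\ldots,r\}$ such that \[ \left\{ \frac{1}{l}\left[\left(lx+k\right)\left(ly+k\right)^{j}\left(lz+k\right)^{ij}-k\right]:i,j\in\left\{ 0,1,\ldots,m\right\} \right\} \subseteq C_{s}. \]
   Context: $\mathbb{N}$ denotes the set of positive integers. Under the hypothesis that $l\neq0$ divides $k(k-1)$, all the displayed numbers are integers. -}

module Defs where

open import Data.Integer using (ℤ; _+_; _*_; _-_; 1ℤ)
open import Data.Nat using (ℕ)
open import Data.Integer using (_^_) public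

prodTerm : ℤ → ℤ → ℤ → ℤ → ℤ → ℕ → ℕ → ℤ
prodTerm l k x y z i j =
  (l * x + k) * ((l * y + k) ^ j) * ((l * z + k) ^ (i Data.Nat.* j))

-- Put w n := (k ^ (n + 1) - k) / l (powerPoint n), an integer because l ∣ k (k - 1); then
-- l w n + k = k ^ (n + 1), so the affine map x ↦ l x + k turns products of the points w n into
-- sums of exponents. Colour n by the colour of w n. By van der Waerden's theorem there is a
-- monochromatic progression α + t (δ + 1), t ≤ m + m², and x = w α, y = z = w δ works, since the
-- product in question is k ^ (α + 1 + (δ + 1) (j + i j)).
--
-- Van der Waerden's theorem is proved by the classical focusing induction on the length: colour
-- blocks of consecutive integers by their colour pattern, find L + 1 equally spaced identical
-- blocks by the previous case, and thereby add one progression of a new colour to a focused family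
-- living in the first block; after r such steps the focus must repeat a colour.
module Submission where

module ArithmeticProgressions where
  open import Data.Nat
  open import Data.Nat.Properties
  open import Data.Nat.Tactic.RingSolver using (solve-∀)
  open import Data.Fin as Fin using (Fin; combine)
  open import Data.Fin.Properties using (combine-injective; any?; pigeonhole)
    renaming (_≟_ to _≟ᶠ_)
  open import Data.Product using (_×_; _,_; proj₁; proj₂; ∃-syntax)
  open import Data.Sum using (_⊎_; inj₁; inj₂)
  open import Data.Empty using (⊥-elim)
  open import Relation.Nullary using (yes; no)
  open import Relation.Binary.PropositionalEquality

  MonochromaticAP : ∀ {r} → (ℕ → Fin r) → (L a d : ℕ) → Set
  MonochromaticAP c L a d = ∀ t → t ≤ L → c (a + t * d) ≡ c a

  MonochromaticAPBelow : ∀ {r} → (ℕ → Fin r) → (L N : ℕ) → Set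
  MonochromaticAPBelow c L N =
    ∃[ a ] ∃[ d ] (1 ≤ d × d ≤ N × a + L * d < N × MonochromaticAP c L a d)

  VanDerWaerden : (L r : ℕ) → Set
  VanDerWaerden L r = ∃[ N ] ((c : ℕ → Fin r) → MonochromaticAPBelow c L N)

  monochromaticAPBelow-translate : ∀ {r} (c : ℕ → Fin r) L {N N'} b →
    MonochromaticAPBelow (λ x → c (b + x)) L N → b + N ≤ N' → MonochromaticAPBelow c L N'
  monochromaticAPBelow-translate c L {N} b (a , d , 1≤d , d≤N , end<N , mono) b+N≤N' =
    b + a , d , 1≤d , ≤-trans d≤N (≤-trans (m≤n+m N b) b+N≤N') ,
    ≤-trans (subst (_< b + N) (sym (+-assoc b a (L * d))) (+-monoʳ-< b end<N)) b+N≤N' ,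
    λ t t≤L → trans (cong c (+-assoc b a (t * d))) (mono t t≤L)

  vanDerWaerden-zero : ∀ r → VanDerWaerden 0 r
  vanDerWaerden-zero r = 1 , λ c → 0 , 1 , ≤-refl , ≤-refl , s≤s z≤n , λ { zero z≤n → refl }

  blockColour : ∀ {r} → (ℕ → Fin r) → (n b : ℕ) → Fin (r ^ n)
  blockColour c zero    b = Fin.zero
  blockColour c (suc n) b = combine (c b) (blockColour c n (suc b))

  blockColour-injective : ∀ {r} (c : ℕ → Fin r) n b b' → blockColour c n b ≡ blockColour c n b' →
    ∀ o → o < n → c (b + o) ≡ c (b' + o)
  blockColour-injective c (suc n) b b' eq zero _
    rewrite +-identityʳ b | +-identityʳ b' = proj₁ (combine-injective (c b) _ (c b') _ eq)
  blockColour-injective c (suc n) b b' eq (suc o) (s≤s o<n)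
    rewrite +-suc b o | +-suc b' o =
    blockColour-injective c n (suc b) (suc b') (proj₂ (combine-injective (c b) _ (c b') _ eq)) o o<n

  RepeatedBlock : ∀ {r} → (ℕ → Fin r) → (L B T D : ℕ) → Set
  RepeatedBlock c L B T D = ∀ t → t ≤ L → ∀ o → o < B → c (T + t * D + o) ≡ c (T + o)

  repeatedBlock : ∀ {r} L B → .{{NonZero B}} → ((W , vdW) : VanDerWaerden L (r ^ B)) →
    (c : ℕ → Fin r) →
    ∃[ T ] ∃[ D ] (1 ≤ D × D ≤ B * W × T + B + L * D ≤ B * W × RepeatedBlock c L B T D)
  repeatedBlock L B (W , vdW) c with vdW (λ b → blockColour c B (B * b))
  ... | b , e , 1≤e , e≤W , end<W , mono =
    B * b , B * e , *-mono-≤ (>-nonZero⁻¹ B) 1≤e , *-monoʳ-≤ B e≤W ,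
    subst (_≤ B * W) (blockEnd B b e L) (*-monoʳ-≤ B end<W) ,
    λ t t≤L o o<B → subst (λ x → c (x + o) ≡ c (B * b + o)) (blockStart B b t e)
      (blockColour-injective c B _ _ (mono t t≤L) o o<B)
    where
    blockEnd : ∀ B b e L → B * suc (b + L * e) ≡ B * b + B + L * (B * e)
    blockEnd = solve-∀
    blockStart : ∀ B b t e → B * (b + t * e) ≡ B * b + t * (B * e)
    blockStart = solve-∀

  record Focused {r} (c : ℕ → Fin r) (L N q : ℕ) : Set where
    field
      focus            : ℕ
      focus<           : focus < 2 * N
      start step       : Fin q → ℕ
      colour           : Fin q → Fin r
      1≤step           : ∀ i → 1 ≤ step i
      inside           : ∀ i → start i + L * step i < N
      reachesFocus     : ∀ i → start i + suc L * step i ≡ focus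
      monochromatic    : ∀ i t → t ≤ L → c (start i + t * step i) ≡ colour i
      colour-injective : ∀ i j → colour i ≡ colour j → i ≡ j

  Focusing : (L r q : ℕ) → Set
  Focusing L r q = ∃[ N ] ((c : ℕ → Fin r) → MonochromaticAPBelow c (suc L) N ⊎ Focused c L N q)

  focusing-zero : ∀ L r → Focusing L r 0
  focusing-zero L r = 1 , λ c → inj₂ (record
    { focus = 0 ; focus< = s≤s z≤n ; start = λ () ; step = λ () ; colour = λ ()
    ; 1≤step = λ () ; inside = λ () ; reachesFocus = λ () ; monochromatic = λ ()
    ; colour-injective = λ () })

  monochromaticAP-extend : ∀ {r} (c : ℕ → Fin r) L a d →
    (∀ t → t ≤ L → c (a + t * d) ≡ c (a + suc L * d)) → MonochromaticAP c (suc L) a d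
  monochromaticAP-extend c L a d same t t≤1+L = trans (toEnd t t≤1+L) (sym atStart)
    where
    toEnd : ∀ t → t ≤ suc L → c (a + t * d) ≡ c (a + suc L * d)
    toEnd t t≤1+L with m≤n⇒m<n∨m≡n t≤1+L
    ... | inj₁ (s≤s t≤L) = same t t≤L
    ... | inj₂ refl      = refl
    atStart : c a ≡ c (a + suc L * d)
    atStart = subst (λ x → c x ≡ c (a + suc L * d)) (+-identityʳ a) (same 0 z≤n)

  focused⇒monochromaticAP : ∀ {r} (c : ℕ → Fin r) {L N q} (fc : Focused c L N q) i →
    Focused.colour fc i ≡ c (Focused.focus fc) → MonochromaticAPBelow c (suc L) (2 * N)
  focused⇒monochromaticAP c {L} {N} fc i colour≡ =
    start i , step i , 1≤step i ,
    ≤-trans (m≤n*m (step i) (suc L)) (≤-trans (m≤n+m _ (start i)) (<⇒≤ end<2N)) , end<2N ,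
    monochromaticAP-extend c L (start i) (step i) λ t t≤L → begin
      c (start i + t * step i) ≡⟨ monochromatic i t t≤L ⟩
      colour i                 ≡⟨ colour≡ ⟩
      c focus                  ≡⟨ cong c (sym (reachesFocus i)) ⟩
      c (start i + suc L * step i) ∎
    where
    open Focused fc
    open ≡-Reasoning
    end<2N : start i + suc L * step i < 2 * N
    end<2N = subst (_< 2 * N) (sym (reachesFocus i)) focus<

  focusing-complete : ∀ L r → Focusing L r r → VanDerWaerden (suc L) r
  focusing-complete L r (M , focusing) = 2 * M , λ c → fromFocusing c (focusing c)
    where
    fromFocusing : (c : ℕ → Fin r) → MonochromaticAPBelow c (suc L) M ⊎ Focused c L M r →
      MonochromaticAPBelow c (suc L) (2 * M)
    fromFocusing c (inj₁ ap) = monochromaticAPBelow-translate c (suc L) 0 ap (m≤m+n M _)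
    fromFocusing c (inj₂ fc) with pigeonhole (n<1+n r) focusOrColour
      where
      open Focused fc
      focusOrColour : Fin (suc r) → Fin r
      focusOrColour Fin.zero    = c focus
      focusOrColour (Fin.suc i) = colour i
    ... | Fin.zero  , Fin.suc i , _ , eq = focused⇒monochromaticAP c fc i (sym eq)
    ... | Fin.suc i , Fin.suc j , i<j , eq with Focused.colour-injective fc i j eq
    ...   | refl = ⊥-elim (<-irrefl refl i<j)

  -- A focused family inside a block that repeats at T + t D, whose focus has a new colour, yields
  -- q + 1 progressions: each old one with step increased by D, and the repeated focus itself.
  focused-extend : ∀ {r} (c : ℕ → Fin r) {L M q} B T D {N} → 2 * M ≤ B → 1 ≤ D → D ≤ N →
    T + B + L * D ≤ N → RepeatedBlock c L B T D → (fc : Focused (λ x → c (T + x)) L M q) →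
    (∀ i → Focused.colour fc i ≢ c (T + Focused.focus fc)) → Focused c L N (suc q)
  focused-extend {r} c {L} {M} {q} B T D {N} 2M≤B 1≤D D≤N blocksEnd repeats fc newColour = record
    { focus = T + f + suc L * D
    ; focus< = subst₂ _<_ (sym (newFocus T f D L)) (sym (double N))
        (+-mono-<-≤ (inside' Fin.zero) D≤N)
    ; start = start' ; step = step' ; colour = colour'
    ; 1≤step = λ { Fin.zero → 1≤D ; (Fin.suc i) → ≤-trans (1≤step i) (m≤m+n _ _) }
    ; inside = inside'
    ; reachesFocus = λ { Fin.zero → refl
        ; (Fin.suc i) → trans (shiftStep T (start i) (suc L) (step i) D)
                          (cong (λ x → T + x + suc L * D) (reachesFocus i)) }
    ; monochromatic = λ { Fin.zero t t≤L → trans (cong c (swapLast T f (t * D)))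
                                             (repeats t t≤L f f<B)
        ; (Fin.suc i) t t≤L → trans (cong c (shiftStep' T (start i) t (step i) D))
                                (trans (repeats t t≤L _ (progression<B i t t≤L))
                                       (monochromatic i t t≤L)) }
    ; colour-injective = λ
        { Fin.zero Fin.zero _ → refl
        ; Fin.zero (Fin.suc j) eq → ⊥-elim (newColour j (sym eq))
        ; (Fin.suc i) Fin.zero eq → ⊥-elim (newColour i eq)
        ; (Fin.suc i) (Fin.suc j) eq → cong Fin.suc (colour-injective i j eq) }
    }
    where
    open Focused fc renaming (focus to f)
    double : ∀ N → 2 * N ≡ N + N
    double = solve-∀
    newFocus : ∀ T f D L → T + f + suc L * D ≡ T + f + L * D + D
    newFocus = solve-∀
    shiftStep : ∀ T a s d D → T + a + s * (d + D) ≡ T + (a + s * d) + s * D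
    shiftStep = solve-∀
    shiftStep' : ∀ T a t d D → T + a + t * (d + D) ≡ T + t * D + (a + t * d)
    shiftStep' = solve-∀
    swapLast : ∀ T f x → T + f + x ≡ T + x + f
    swapLast = solve-∀
    M≤B : M ≤ B
    M≤B = ≤-trans (m≤m+n M _) 2M≤B
    f<B : f < B
    f<B = <-≤-trans focus< 2M≤B
    progression<B : ∀ i t → t ≤ L → start i + t * step i < B
    progression<B i t t≤L =
      ≤-<-trans (+-monoʳ-≤ (start i) (*-monoˡ-≤ (step i) t≤L)) (<-≤-trans (inside i) M≤B)
    start' step' : Fin (suc q) → ℕ
    start' Fin.zero    = T + f
    start' (Fin.suc i) = T + start i
    step' Fin.zero    = D
    step' (Fin.suc i) = step i + D
    colour' : Fin (suc q) → Fin r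
    colour' Fin.zero    = c (T + f)
    colour' (Fin.suc i) = colour i
    withinBlocks : ∀ {x} → x < B → T + x + L * D < N
    withinBlocks x<B = <-≤-trans (+-monoˡ-< (L * D) (+-monoʳ-< T x<B)) blocksEnd
    inside' : ∀ i → start' i + L * step' i < N
    inside' Fin.zero    = withinBlocks f<B
    inside' (Fin.suc i) = subst (_< N) (sym (shiftStep T (start i) L (step i) D))
                            (withinBlocks (<-≤-trans (inside i) M≤B))

  focusing-step : ∀ L r q → (∀ R → VanDerWaerden L R) → Focusing L r q → Focusing L r (suc q)
  focusing-step L r q vdW (M , focusing) = N , extend
    where
    -- a block has room for a whole focused family of the previous stage together with its focus
    B : ℕ
    B = suc (2 * M)
    N : ℕ
    N = B * proj₁ (vdW (r ^ B))
    extend : (c : ℕ → Fin r) → MonochromaticAPBelow c (suc L) N ⊎ Focused c L N (suc q)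
    extend c with repeatedBlock L B (vdW (r ^ B)) c
    ... | T , D , 1≤D , D≤N , blocksEnd , repeats = fromBlock (focusing (λ x → c (T + x)))
      where
      inBlock : ∀ {x} → x ≤ B → T + x ≤ N
      inBlock x≤B = ≤-trans (+-monoʳ-≤ T x≤B) (≤-trans (m≤m+n (T + B) (L * D)) blocksEnd)
      fromBlock : MonochromaticAPBelow (λ x → c (T + x)) (suc L) M ⊎ Focused (λ x → c (T + x)) L M q →
        MonochromaticAPBelow c (suc L) N ⊎ Focused c L N (suc q)
      fromBlock (inj₁ ap) =
        inj₁ (monochromaticAPBelow-translate c (suc L) T ap (inBlock (≤-trans (m≤m+n M _) (n≤1+n _))))
      fromBlock (inj₂ fc) with any? (λ i → Focused.colour fc i ≟ᶠ c (T + Focused.focus fc))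
      ... | yes (i , sameColour) = inj₁ (monochromaticAPBelow-translate c (suc L) T
              (focused⇒monochromaticAP (λ x → c (T + x)) fc i sameColour) (inBlock (n≤1+n _)))
      ... | no freshColour = inj₂ (focused-extend c B T D (n≤1+n _) 1≤D D≤N blocksEnd repeats fc
              λ i sameColour → freshColour (i , sameColour))

  vanDerWaerden : ∀ L r → VanDerWaerden L r
  vanDerWaerden zero    r = vanDerWaerden-zero r
  vanDerWaerden (suc L) r = focusing-complete L r (focusing r)
    where
    focusing : ∀ q → Focusing L r q
    focusing zero    = focusing-zero L r
    focusing (suc q) = focusing-step L r q (vanDerWaerden L) (focusing q)

open import Defs
open import Data.Integer using (ℤ; _+_; _*_; _-_; 0ℤ; 1ℤ)
open import Data.Integer.Divisibility using (_∣_)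
open import Data.Nat using (ℕ; _≤_)
open import Data.Fin using (Fin)
open import Data.Product using (Σ; _×_; ∃-syntax)
open import Relation.Binary.PropositionalEquality using (_≡_; _≢_)

open import Data.Product using (_,_; proj₂)
open import Relation.Binary.PropositionalEquality using (sym; cong; cong₂; module ≡-Reasoning)
import Data.Nat as ℕ
import Data.Nat.Properties as ℕ
import Data.Nat.Tactic.RingSolver as ℕ
open import Data.Integer.Properties using (^-*-assoc; ^-distribˡ-+-*)
open import Data.Integer.Divisibility.Signed using (∣ᵤ⇒∣; divides)
open import Data.Integer.Tactic.RingSolver using (solve-∀)
open ArithmeticProgressions using (vanDerWaerden)

^-product : ∀ a x y n n' → a ^ x * (a ^ y) ^ n * (a ^ y) ^ n' ≡ a ^ (x ℕ.+ y ℕ.* (n ℕ.+ n'))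
^-product a x y n n' = begin
  a ^ x * (a ^ y) ^ n * (a ^ y) ^ n'        ≡⟨ cong₂ (λ u v → a ^ x * u * v) (^-*-assoc a y n) (^-*-assoc a y n') ⟩
  a ^ x * a ^ (y ℕ.* n) * a ^ (y ℕ.* n')    ≡⟨ cong (_* a ^ (y ℕ.* n')) (sym (^-distribˡ-+-* a x _)) ⟩
  a ^ (x ℕ.+ y ℕ.* n) * a ^ (y ℕ.* n')      ≡⟨ sym (^-distribˡ-+-* a (x ℕ.+ y ℕ.* n) _) ⟩
  a ^ (x ℕ.+ y ℕ.* n ℕ.+ y ℕ.* n')          ≡⟨ cong (a ^_) (exponents x y n n') ⟩
  a ^ (x ℕ.+ y ℕ.* (n ℕ.+ n'))              ∎
  where
  open ≡-Reasoning
  exponents : ∀ x y n n' → x ℕ.+ y ℕ.* n ℕ.+ y ℕ.* n' ≡ x ℕ.+ y ℕ.* (n ℕ.+ n')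
  exponents = ℕ.solve-∀

module PowerPoints (l k p : ℤ) (k[k-1]≡pl : k * (k - 1ℤ) ≡ p * l) where

  powerPoint : ℕ → ℤ
  powerPoint ℕ.zero    = 0ℤ
  powerPoint (ℕ.suc n) = k * powerPoint n + p

  powerPoint-affine : ∀ n → l * powerPoint n + k ≡ k ^ ℕ.suc n
  powerPoint-affine ℕ.zero    = base l k
    where
    base : ∀ l k → l * 0ℤ + k ≡ k * 1ℤ
    base = solve-∀
  powerPoint-affine (ℕ.suc n) = begin
    l * (k * w + p) + k              ≡⟨ expand l k w p ⟩
    k * (l * w) + p * l + k          ≡⟨ cong (λ x → k * (l * w) + x + k) (sym k[k-1]≡pl) ⟩
    k * (l * w) + k * (k - 1ℤ) + k   ≡⟨ collect l k w ⟩
    k * (l * w + k)                  ≡⟨ cong (k *_) (powerPoint-affine n) ⟩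
    k * k ^ ℕ.suc n                  ∎
    where
    open ≡-Reasoning
    w = powerPoint n
    expand : ∀ l k w p → l * (k * w + p) + k ≡ k * (l * w) + p * l + k
    expand = solve-∀
    collect : ∀ l k w → k * (l * w) + k * (k - 1ℤ) + k ≡ k * (l * w + k)
    collect = solve-∀

  prodTerm-powerPoint : ∀ α δ i j →
    prodTerm l k (powerPoint α) (powerPoint δ) (powerPoint δ) i j
      ≡ l * powerPoint (α ℕ.+ (j ℕ.+ i ℕ.* j) ℕ.* ℕ.suc δ) + k
  prodTerm-powerPoint α δ i j = begin
    prodTerm l k (powerPoint α) (powerPoint δ) (powerPoint δ) i j
      ≡⟨ cong₂ (λ u v → u * v ^ j * v ^ (i ℕ.* j)) (powerPoint-affine α) (powerPoint-affine δ) ⟩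
    k ^ ℕ.suc α * (k ^ ℕ.suc δ) ^ j * (k ^ ℕ.suc δ) ^ (i ℕ.* j)
      ≡⟨ ^-product k (ℕ.suc α) (ℕ.suc δ) j (i ℕ.* j) ⟩
    k ^ (ℕ.suc α ℕ.+ ℕ.suc δ ℕ.* (j ℕ.+ i ℕ.* j))
      ≡⟨ cong (k ^_) (exponent α δ (j ℕ.+ i ℕ.* j)) ⟩
    k ^ ℕ.suc (α ℕ.+ (j ℕ.+ i ℕ.* j) ℕ.* ℕ.suc δ)
      ≡⟨ sym (powerPoint-affine (α ℕ.+ (j ℕ.+ i ℕ.* j) ℕ.* ℕ.suc δ)) ⟩
    l * powerPoint (α ℕ.+ (j ℕ.+ i ℕ.* j) ℕ.* ℕ.suc δ) + k ∎
    where
    open ≡-Reasoning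
    exponent : ∀ α δ t → ℕ.suc α ℕ.+ ℕ.suc δ ℕ.* t ≡ ℕ.suc (α ℕ.+ t ℕ.* ℕ.suc δ)
    exponent = ℕ.solve-∀

  monochromaticProducts : (r : ℕ) → (c : ℤ → Fin r) → (m : ℕ) →
    ∃[ x ] ∃[ y ] ∃[ z ] ∃[ s ]
    ((i j : ℕ) → i ≤ m → j ≤ m →
    ∃[ w ] ((l * w + k ≡ prodTerm l k x y z i j) × (c w ≡ s)))
  monochromaticProducts r c m
    with proj₂ (vanDerWaerden (m ℕ.+ m ℕ.* m) r) (λ n → c (powerPoint n))
  ... | α , ℕ.suc δ , _ , _ , _ , monochromatic =
    powerPoint α , powerPoint δ , powerPoint δ , c (powerPoint α) ,
    λ i j i≤m j≤m → powerPoint (α ℕ.+ (j ℕ.+ i ℕ.* j) ℕ.* ℕ.suc δ) ,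
      sym (prodTerm-powerPoint α δ i j) ,
      monochromatic (j ℕ.+ i ℕ.* j) (ℕ.+-mono-≤ j≤m (ℕ.*-mono-≤ i≤m j≤m))

mainTheorem2 : (l k : ℤ) → l ≢ 0ℤ → l ∣ k * (k - 1ℤ) →
    (r : ℕ) → (c : ℤ → Fin r) → (m : ℕ) →
    ∃[ x ] ∃[ y ] ∃[ z ] ∃[ s ]
    ((i j : ℕ) → i ≤ m → j ≤ m →
    ∃[ w ] ((l * w + k ≡ prodTerm l k x y z i j) × (c w ≡ s)))
mainTheorem2 l k _ l∣k[k-1] with ∣ᵤ⇒∣ l∣k[k-1]
... | divides p k[k-1]≡pl = PowerPoints.monochromaticProducts l k p k[k-1]≡pl
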